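{- Let $G$ be a connected graph with cut decomposition $(X,\mathcal{C})$, and let $v$ be a node of $X$. Suppose the survivor is restricted to the component of $v$, i.e. its position is always in $\bigcup_{y\in\Lambda_X(v)}C_y$. Then $\mathrm{load}^*(v)$ lazy zombies, starting from any vertices of $G$, can capture the survivor in at most $\mathrm{time}^*(v)$ rounds.
   Context: Lazy zombies and survivor game on a connected graph $G$: each round, first every lazy zombie either stays at its current vertex $u$ or moves to a neighbour of $u$ lying on a shortest path in $G$ from $u$ to the survivor's current vertex; then the survivor stays or moves to an adjacent vertex; full information; capture means a lazy zombie occupies the survivor's vertex. $\delta(G)$ is the diameter of $G$. A cut decomposition of $G$ is a pair $(X,\mathcal{C})$ where $X$ is a rooted tree and $\mathcal{C}=\{C_x\subseteq V(G)\}_{x\in V(X)}$ such that: every vertex lies in a unique $C_x$; for every edge $uv$ there are $x,y$ with $u\in C_x$, $v\in C_y$ and $x$ an ancestor of $y$ (a node is its own ancestor); for every non-leaf $y$, $C_y$ is a cut set of $G[\bigcup_{x\in\Lambda_X(y)}C_x]$, $\Lambda_X(y)$ being the subtree of $X$ rooted at $y$. For $S\subseteq V(G)$, $\theta(S)$ is the clique cover number of $G[S]$. Define $\mathrm{load}^*(v)=\theta(C_v)$ if $v$ is a leaf and $\mathrm{load}^*(v)=\theta(C_v)+\max_w\mathrm{load}^*(w)$ over children $w$ otherwise; $\mathrm{time}^*(v)=\theta(C_v)\delta(G)+1$ if $v$ is a leaf and $\mathrm{time}^*(v)=(\theta(C_v)\delta(G)+1)\max_w\mathrm{time}^*(w)$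 otherwise. -}

module Defs where

open import Data.Nat using (ℕ; zero; suc; _+_; _*_; _≤_; _⊔_)
open import Data.Fin using (Fin)
open import Data.Fin.Subset using (Subset; _∈_; _∉_; _∪_; _⊆_) renaming (⊥ to ∅)
open import Data.Bool using (Bool; T; false)
open import Data.List using (List; []; _∷_; _++_)
open import Data.Maybe using (Maybe; just; nothing)
open import Data.Product using (Σ; ∃; ∃₂; _×_; _,_)
open import Data.Sum using (_⊎_)
open import Data.Unit using (⊤)
open import Relation.Binary.PropositionalEquality using (_≡_; _≢_)
open import Relation.Nullary using (¬_)

record Graph (n : ℕ) : Set where
  field
    adj        : Fin n → Fin n → Bool
    adj-sym    : ∀ u v → adj u v ≡ adj v u
    adj-irrefl : ∀ u → adj u u ≡ false

module _ {n : ℕ} (G : Graph n) where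
  open Graph G

  Adj : Fin n → Fin n → Set
  Adj u v = T (adj u v)

  data WalkIn (P : Fin n → Set) : Fin n → Fin n → ℕ → Set where
    stay : ∀ {u} → P u → WalkIn P u u 0
    step : ∀ {u w v k} → P u → Adj u w → WalkIn P w v k → WalkIn P u v (suc k)

  Walk : Fin n → Fin n → ℕ → Set
  Walk = WalkIn (λ _ → ⊤)

  Connected : Set
  Connected = ∀ u v → ∃ λ k → Walk u v k

  IsDist : Fin n → Fin n → ℕ → Set
  IsDist u v d = Walk u v d × (∀ k → Walk u v k → d ≤ k)

  IsDistance : (Fin n → Fin n → ℕ) → Set
  IsDistance dist = ∀ u v → IsDist u v (dist u v)

  IsDiameter : (Fin n → Fin n → ℕ) → ℕ → Set
  IsDiameter dist D = (∀ u v → dist u v ≤ D) × ∃₂ λ u v → dist u v ≡ D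

  IsClique : Subset n → Set
  IsClique K = ∀ u v → u ∈ K → v ∈ K → u ≢ v → Adj u v

  HasCliqueCover : Subset n → ℕ → Set
  HasCliqueCover S k =
    Σ (Fin k → Subset n) λ K →
      (∀ i → K i ⊆ S) × (∀ i → IsClique (K i)) × (∀ u → u ∈ S → ∃ λ i → u ∈ K i)

  IsCliqueCoverNumber : Subset n → ℕ → Set
  IsCliqueCoverNumber S k = HasCliqueCover S k × (∀ j → HasCliqueCover S j → k ≤ j)

  IsCutSet : Subset n → Subset n → Set
  IsCutSet C L =
    ∃₂ λ a b → R a × R b × (∀ k → ¬ WalkIn R a b k)
    where
      R : Fin n → Set
      R u = u ∈ L × u ∉ C

-- Finite rooted (rose) trees with labels; nodes are addressed by paths
-- (lists of child indices) from the root.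

data RTree (A : Set) : Set where
  node : A → List (RTree A) → RTree A

module _ {A : Set} where
  label : RTree A → A
  label (node a _) = a

  children : RTree A → List (RTree A)
  children (node _ ts) = ts

  mutual
    at : RTree A → List ℕ → Maybe (RTree A)
    at t [] = just t
    at (node _ ts) (i ∷ p) = atList ts i p

    atList : List (RTree A) → ℕ → List ℕ → Maybe (RTree A)
    atList [] _ _ = nothing
    atList (t ∷ ts) zero p = at t p
    atList (t ∷ ts) (suc i) p = atList ts i p

_≼_ : List ℕ → List ℕ → Set
p ≼ q = ∃ λ r → q ≡ p ++ r

module _ {n : ℕ} where
  mutual
    -- ⋃_{x ∈ Λ(v)} C_x for the subtree v
    comp : RTree (Subset n) → Subset n
    comp (node C ts) = C ∪ compList ts

    compList : List (RTree (Subset n)) → Subset n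
    compList [] = ∅
    compList (t ∷ ts) = comp t ∪ compList ts

  InNode : RTree (Subset n) → Fin n → List ℕ → Set
  InNode X u p = ∃ λ t → at X p ≡ just t × u ∈ label t

  record IsCutDecomposition (G : Graph n) (X : RTree (Subset n)) : Set where
    field
      cover  : ∀ u → ∃ λ p → InNode X u p
      unique : ∀ u p q → InNode X u p → InNode X u q → p ≡ q
      edges  : ∀ u v → Adj G u v →
               ∃₂ λ p q → InNode X u p × InNode X v q × (p ≼ q ⊎ q ≼ p)
      cuts   : ∀ p t → at X p ≡ just t → children t ≢ [] →
               IsCutSet G (label t) (comp t)

  module _ (θ : Subset n → ℕ) where
    mutual
      load* : RTree (Subset n) → ℕ
      load* (node C []) = θ C
      load* (node C (t ∷ ts)) = θ C + maxLoad (t ∷ ts)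

      maxLoad : List (RTree (Subset n)) → ℕ
      maxLoad [] = 0
      maxLoad (t ∷ ts) = load* t ⊔ maxLoad ts

    module _ (δ : ℕ) where
      mutual
        time* : RTree (Subset n) → ℕ
        time* (node C []) = θ C * δ + 1
        time* (node C (t ∷ ts)) = (θ C * δ + 1) * maxTime (t ∷ ts)

        maxTime : List (RTree (Subset n)) → ℕ
        maxTime [] = 0
        maxTime (t ∷ ts) = time* t ⊔ maxTime ts

module _ {n : ℕ} (G : Graph n) (dist : Fin n → Fin n → ℕ) (S : Subset n) {k : ℕ} where

  Captured : (Fin k → Fin n) → Fin n → Set
  Captured zs s = ∃ λ i → zs i ≡ s

  ZombieStep : Fin n → Fin n → Fin n → Set
  ZombieStep s u w = w ≡ u ⊎ (Adj G u w × dist u w + dist w s ≡ dist u s)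

  SurvivorStep : Fin n → Fin n → Set
  SurvivorStep s s' = (s' ≡ s ⊎ Adj G s s') × s' ∈ S

  CanCapture : ℕ → (Fin k → Fin n) → Fin n → Set
  CanCapture zero zs s = Captured zs s
  CanCapture (suc T) zs s =
    Captured zs s ⊎
    ∃ λ zs' → (∀ i → ZombieStep s (zs i) (zs' i)) ×
      (Captured zs' s ⊎ (∀ s' → SurvivorStep s s' → CanCapture T zs' s'))

module Submission where

-- At a node with bag C, cover C by θ(C)
-- cliques and give each clique a guard zombie; the remaining zombies form a
-- team shared by the children. While the survivor stands in a clique K, the
-- guard of K makes a lazy move that captures or brings it closer to K, so the
-- total distance of the guards to their cliques, at most θ(C)·δ initially,
-- bounds the number of such rounds. While the survivor is in the component
-- of a child w, the guards stand still and the team plays w's strategy for at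
-- most time*(w) rounds; since the bags of the two ends of an edge lie on a
-- common root path of X, the survivor can then only step into C or out of
-- the component of the node. This gives (θ(C)·δ + 1)·max time*(w) rounds.

open import Defs
open import Data.Bool using (T)
open import Data.Empty using (⊥; ⊥-elim)
open import Data.Fin using (Fin; _≟_; punchIn)
open import Data.Fin.Properties using (+↔⊎; punchInᵢ≢i)
open import Data.Fin.Subset using (Subset; _∈_; _∉_)
open import Data.Fin.Subset.Properties using (x∈p∪q⁻; x∈p∪q⁺; ∉⊥; _∈?_)
open import Data.List using (List; []; _∷_; _++_)
open import Data.List.Properties using (++-assoc; ++-cancelˡ; ∷-injectiveˡ)
open import Data.Maybe using (just)
open import Data.Maybe.Properties using (just-injective)
open import Data.Nat using (ℕ; zero; suc; pred; _+_; _*_; _≤_; _<_; _<?_; z≤n; s≤s; s≤s⁻¹; >-nonZero)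
open import Data.Nat.Properties hiding (_≟_)
open import Algebra.Properties.CommutativeMonoid.Sum +-0-commutativeMonoid using (sum; sum-remove; sum-cong-≗)
open import Data.Product using (∃; _×_; _,_; proj₁; proj₂)
open import Data.Sum as Sum using (_⊎_; inj₁; inj₂)
open import Data.Sum.Algebra using (⊎-assoc; ⊎-cong; ⊎-comm; ⊎-identityʳ)
open import Data.Unit using (tt)
open import Data.Vec.Functional using (Vector; updateAt; removeAt)
open import Data.Vec.Functional.Properties using (updateAt-updates; updateAt-minimal)
open import Function using (id; _∘_; _↔_; Inverse)
open import Function.Construct.Composition using (_↔-∘_)
open import Function.Construct.Identity using (↔-id)
open import Function.Properties.Inverse using (↔-sym)
open import Level using (0ℓ; Lift)
open import Relation.Binary.PropositionalEquality
open import Relation.Nullary using (¬_; yes; no)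

module Distance {n : ℕ} (G : Graph n) (dist : Fin n → Fin n → ℕ) (isDist : IsDistance G dist) where

  LazyMove : Fin n → Fin n → Fin n → Set
  LazyMove s u w = w ≡ u ⊎ (Adj G u w × dist u w + dist w s ≡ dist u s)

  -- Vacuous for empty K, which a clique cover may contain.
  WithinDist : ℕ → Fin n → Subset n → Set
  WithinDist d z K = ∀ {y} → y ∈ K → ∃ λ x → x ∈ K × dist z x ≤ d

  walk-++ : ∀ {u v w a b} → Walk G u v a → Walk G v w b → Walk G u w (a + b)
  walk-++ (stay _)       q = q
  walk-++ (step _ uw r) q = step tt uw (walk-++ r q)

  dist-minimal : ∀ {u v k} → Walk G u v k → dist u v ≤ k
  dist-minimal = proj₂ (isDist _ _) _

  dist-triangle : ∀ u v w → dist u w ≤ dist u v + dist v w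
  dist-triangle u v w = dist-minimal (walk-++ (proj₁ (isDist u v)) (proj₁ (isDist v w)))

  dist-refl : ∀ u → dist u u ≡ 0
  dist-refl u = n≤0⇒n≡0 (dist-minimal (stay tt))

  dist≡0⇒≡ : ∀ {u v} → dist u v ≡ 0 → u ≡ v
  dist≡0⇒≡ {u} {v} d≡0 = length0 (subst (Walk G u v) d≡0 (proj₁ (isDist u v)))
    where
      length0 : ∀ {u v} → Walk G u v 0 → u ≡ v
      length0 (stay _) = refl

  adj-irrefl : ∀ {u} → ¬ Adj G u u
  adj-irrefl {u} uu = subst T (Graph.adj-irrefl G u) uu

  adj⇒dist≡1 : ∀ {u v} → Adj G u v → dist u v ≡ 1
  adj⇒dist≡1 {u} {v} uv with dist u v in d | dist-minimal (step tt uv (stay tt))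
  ... | zero     | _         = ⊥-elim (adj-irrefl (subst (Adj G u) (sym (dist≡0⇒≡ d)) uv))
  ... | suc zero | _         = refl
  ... | suc (suc _) | s≤s ()

  dist-suc⇒step : ∀ {u v k} → dist u v ≡ suc k → ∃ λ w → Adj G u w × dist w v ≡ k
  dist-suc⇒step {u} {v} {k} d with subst (Walk G u v) d (proj₁ (isDist u v))
  ... | step {w = w} _ uw wv = w , uw , ≤-antisym (dist-minimal wv) k≤
    where
      k≤ : k ≤ dist w v
      k≤ = s≤s⁻¹ (begin
        suc k               ≡⟨ sym d ⟩
        dist u v            ≤⟨ dist-triangle u w v ⟩
        dist u w + dist w v ≡⟨ cong (_+ dist w v) (adj⇒dist≡1 uw) ⟩
        suc (dist w v)      ∎)
        where open ≤-Reasoning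

  geodesic-move : ∀ {u w s} → Adj G u w → suc (dist w s) ≡ dist u s → LazyMove s u w
  geodesic-move {w = w} {s} uw d = inj₂ (uw , trans (cong (_+ dist w s) (adj⇒dist≡1 uw)) d)

  move-toward : ∀ {u s k} → dist u s ≡ suc k → ∃ λ w → LazyMove s u w × dist w s ≡ k
  move-toward d with dist-suc⇒step d
  ... | w , uw , ws = w , geodesic-move uw (trans (cong suc ws) (sym d)) , ws

  clique⇒dist≤1 : ∀ {K} → IsClique G K → ∀ {x y} → x ∈ K → y ∈ K → dist x y ≤ 1
  clique⇒dist≤1 cl {x} {y} xK yK with x ≟ y
  ... | yes refl = subst (_≤ 1) (sym (dist-refl x)) z≤n
  ... | no x≢y   = ≤-reflexive (adj⇒dist≡1 (cl x y xK yK x≢y))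

  move-toward-near : ∀ {x s z k} → dist x s ≤ 1 → dist z x ≡ suc k → dist z s ≡ suc (suc k) →
    ∃ λ w → LazyMove s z w × dist w x ≡ k
  move-toward-near {x} {s} {z} {k} xs≤1 zx zs with dist-suc⇒step zx
  ... | w , zw , wx = w , geodesic-move zw (trans (cong suc (≤-antisym ws≤ ≤ws)) (sym zs)) , wx
    where
      open ≤-Reasoning
      ws≤ : dist w s ≤ suc k
      ws≤ = begin
        dist w s            ≤⟨ dist-triangle w x s ⟩
        dist w x + dist x s ≤⟨ +-monoʳ-≤ (dist w x) xs≤1 ⟩
        dist w x + 1        ≡⟨ cong (_+ 1) wx ⟩
        k + 1               ≡⟨ +-comm k 1 ⟩
        suc k               ∎
      ≤ws : suc k ≤ dist w s
      ≤ws = s≤s⁻¹ (begin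
        suc (suc k)         ≡⟨ sym zs ⟩
        dist z s            ≤⟨ dist-triangle z w s ⟩
        dist z w + dist w s ≡⟨ cong (_+ dist w s) (adj⇒dist≡1 zw) ⟩
        suc (dist w s)      ∎)

  clique-chase : ∀ {K} → IsClique G K → ∀ {x s} → x ∈ K → s ∈ K → ∀ z →
    ∃ λ z' → LazyMove s z z' × (z' ≡ s ⊎ ∃ λ x' → x' ∈ K × dist z' x' < dist z x)
  clique-chase {K} cl {x} {s} xK sK z with z ≟ s
  ... | yes z≡s = z , inj₁ refl , inj₁ z≡s
  ... | no z≢s = chase (dist z s) refl
    where
      open ≤-Reasoning
      Chased : Set
      Chased = ∃ λ z' → LazyMove s z z' × (z' ≡ s ⊎ ∃ λ x' → x' ∈ K × dist z' x' < dist z x)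

      xs≤1 : dist x s ≤ 1
      xs≤1 = clique⇒dist≤1 cl xK sK

      far : ∀ j → dist z s ≡ suc j → dist z x ≡ j → Chased
      far zero    zs zx = let w , mv , ws = move-toward zs in w , mv , inj₁ (dist≡0⇒≡ ws)
      far (suc k) zs zx = let w , mv , wx = move-toward-near xs≤1 zx zs in
        w , mv , inj₂ (x , xK , subst₂ _<_ (sym wx) (sym zx) ≤-refl)

      chase : ∀ d → dist z s ≡ d → Chased
      chase zero    zs = ⊥-elim (z≢s (dist≡0⇒≡ zs))
      chase (suc j) zs with j <? dist z x
      ... | yes j<zx = let w , mv , ws = move-toward zs in
        w , mv , inj₂ (s , sK , subst (_< dist z x) (sym ws) j<zx)
      ... | no j≮zx = far j zs (≤-antisym (≮⇒≥ j≮zx) (s≤s⁻¹ (begin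
        suc j               ≡⟨ sym zs ⟩
        dist z s            ≤⟨ dist-triangle z x s ⟩
        dist z x + dist x s ≤⟨ +-monoʳ-≤ (dist z x) xs≤1 ⟩
        dist z x + 1        ≡⟨ +-comm (dist z x) 1 ⟩
        suc (dist z x)      ∎)))

module Pursuit {V : Set} (ZombieMove : V → V → V → Set) (SurvivorMove : V → V → Set) where

  Caught : {I : Set} → (I → V) → V → Set
  Caught zs s = ∃ λ i → zs i ≡ s

  -- Reaching Q only counts while at least one round remains.
  CanCaptureOr : {I : Set} → ℕ → ((I → V) → V → Set) → (I → V) → V → Set
  CanCaptureOr zero    Q zs s = Caught zs s
  CanCaptureOr (suc T) Q zs s = Caught zs s ⊎ Q zs s ⊎
    ∃ λ zs' → (∀ i → ZombieMove s (zs i) (zs' i)) ×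
      (Caught zs' s ⊎ ∀ s' → SurvivorMove s s' → CanCaptureOr T Q zs' s')

  private
    variable
      I : Set
      Q R : (I → V) → V → Set
      zs : I → V
      s : V

  caught⇒canCaptureOr : ∀ T → Caught zs s → CanCaptureOr T Q zs s
  caught⇒canCaptureOr zero    c = c
  caught⇒canCaptureOr (suc T) c = inj₁ c

  goal⇒canCaptureOr : ∀ {T} → 1 ≤ T → Q zs s → CanCaptureOr T Q zs s
  goal⇒canCaptureOr {T = suc T} _ q = inj₂ (inj₁ q)

  canCaptureOr-mono-≤ : ∀ {T T′} → T ≤ T′ → CanCaptureOr T Q zs s → CanCaptureOr T′ Q zs s
  canCaptureOr-mono-≤ {T = zero} {T′} _ c = caught⇒canCaptureOr T′ c
  canCaptureOr-mono-≤ {T = suc T} {suc T′} (s≤s T≤T′) g with g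
  ... | inj₁ c                           = inj₁ c
  ... | inj₂ (inj₁ q)                    = inj₂ (inj₁ q)
  ... | inj₂ (inj₂ (zs' , mv , inj₁ c))  = inj₂ (inj₂ (zs' , mv , inj₁ c))
  ... | inj₂ (inj₂ (zs' , mv , inj₂ next)) =
    inj₂ (inj₂ (zs' , mv , inj₂ λ s' sm → canCaptureOr-mono-≤ T≤T′ (next s' sm)))

  canCaptureOr-bind : ∀ {T₁ T₂} → 1 ≤ T₁ → CanCaptureOr T₁ Q zs s →
    (∀ {zs s} → Q zs s → CanCaptureOr (suc T₂) R zs s) → CanCaptureOr (T₁ + T₂) R zs s
  canCaptureOr-bind {Q = Q} {R = R} {T₁ = suc T₁} {T₂} _ g k with g
  ... | inj₁ c                           = inj₁ c
  ... | inj₂ (inj₁ q)                    = canCaptureOr-mono-≤ (s≤s (m≤n+m T₂ T₁)) (k q)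
  ... | inj₂ (inj₂ (zs' , mv , inj₁ c))  = inj₂ (inj₂ (zs' , mv , inj₁ c))
  ... | inj₂ (inj₂ (zs' , mv , inj₂ next)) =
    inj₂ (inj₂ (zs' , mv , inj₂ λ s' sm → continue T₁ (next s' sm)))
    where
      continue : ∀ T {zs s} → CanCaptureOr T Q zs s → CanCaptureOr (T + T₂) R zs s
      continue zero    c = caught⇒canCaptureOr T₂ c
      continue (suc T) g = canCaptureOr-bind (s≤s z≤n) g k

  module _ {J : Set} (e : I ↔ J) where
    open Inverse e

    caught-reindex : ∀ {ys : J → V} → zs ≗ ys ∘ to → Caught ys s → Caught zs s
    caught-reindex {zs = zs} {ys = ys} zs≗ (j , ys≡) =
      from j , trans (zs≗ (from j)) (trans (cong ys (strictlyInverseˡ j)) ys≡)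

    canCaptureOr-reindex : ∀ {Q : (J → V) → V → Set} {T ys} →
      (∀ ys {zs s} → zs ≗ ys ∘ to → Q ys s → R zs s) →
      zs ≗ ys ∘ to → CanCaptureOr T Q ys s → CanCaptureOr T R zs s
    canCaptureOr-reindex {T = zero}  _ zs≗ c = caught-reindex zs≗ c
    canCaptureOr-reindex {zs = zs} {s = s} {T = suc T} transfer zs≗ g with g
    ... | inj₁ c        = inj₁ (caught-reindex zs≗ c)
    ... | inj₂ (inj₁ q) = inj₂ (inj₁ (transfer _ zs≗ q))
    ... | inj₂ (inj₂ (ys' , mv , after)) = inj₂ (inj₂ (ys' ∘ to , mv′ , Sum.map (caught-reindex (λ _ → refl))
            (λ next s' sm → canCaptureOr-reindex transfer (λ _ → refl) (next s' sm)) after))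
      where
        mv′ : ∀ i → ZombieMove s (zs i) (ys' (to i))
        mv′ i = subst (λ z → ZombieMove s z (ys' (to i))) (sym (zs≗ i)) (mv (to i))

regroup : {A B C O : Set} → A ↔ (B ⊎ C) → (A ⊎ O) ↔ (B ⊎ (C ⊎ O))
regroup {O = O} e = ⊎-assoc 0ℓ _ _ O ↔-∘ ⊎-cong e (↔-id O)

Fin-split : ∀ {L M} → L ≤ M → ∃ λ r → Fin M ↔ (Fin L ⊎ Fin r)
Fin-split L≤M with m≤n⇒∃[o]m+o≡n L≤M
... | r , refl = r , +↔⊎

load*-↔ : ∀ {n} (θ : Subset n → ℕ) C ts → Fin (load* θ (node C ts)) ↔ (Fin (maxLoad θ ts) ⊎ Fin (θ C))
load*-↔ θ C []       = +↔⊎ {0}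
load*-↔ θ C (t ∷ ts) = ⊎-comm _ _ ↔-∘ +↔⊎

module _ {A : Set} where
  mutual
    at-++ : ∀ (t : RTree A) p q {u} → at t p ≡ just u → at t (p ++ q) ≡ at u q
    at-++ t           []      q refl = refl
    at-++ (node _ ts) (i ∷ p) q at≡  = atList-++ ts i p q at≡

    atList-++ : ∀ (ts : List (RTree A)) i p q {u} → atList ts i p ≡ just u → atList ts i (p ++ q) ≡ at u q
    atList-++ (t ∷ ts) zero    p q at≡ = at-++ t p q at≡
    atList-++ (t ∷ ts) (suc i) p q at≡ = atList-++ ts i p q at≡

≼-sibling : ∀ p {i j : ℕ} {r₁ r₂} → (p ++ i ∷ r₁) ≼ (p ++ j ∷ r₂) → i ≡ j
≼-sibling p {i} {j} {r₁} {r₂} (r , eq) =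
  sym (∷-injectiveˡ (++-cancelˡ p (j ∷ r₂) (i ∷ r₁ ++ r) (trans eq (++-assoc p (i ∷ r₁) r))))

module _ {n : ℕ} where

  mutual
    ∈comp⇒InNode : ∀ (t : RTree (Subset n)) {x} → x ∈ comp t → ∃ λ r → InNode t x r
    ∈comp⇒InNode (node C ts) x∈ with x∈p∪q⁻ C (compList ts) x∈
    ... | inj₁ x∈C  = [] , node C ts , refl , x∈C
    ... | inj₂ x∈ts = let i , r , x∈ = ∈compList⇒InNode ts {C} x∈ts in i ∷ r , x∈

    ∈compList⇒InNode : ∀ (ts : List (RTree (Subset n))) {C x} → x ∈ compList ts → ∃ λ i → ∃ λ r → InNode (node C ts) x (i ∷ r)
    ∈compList⇒InNode []       x∈ = ⊥-elim (∉⊥ x∈)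
    ∈compList⇒InNode (t ∷ ts) x∈ with x∈p∪q⁻ (comp t) (compList ts) x∈
    ... | inj₁ x∈t  = let r , x∈ = ∈comp⇒InNode t x∈t in zero , r , x∈
    ... | inj₂ x∈ts = let i , r , x∈ = ∈compList⇒InNode ts {label t} x∈ts in suc i , r , x∈

  InNode-++ : ∀ {X t : RTree (Subset n)} {x} p q → at X p ≡ just t → InNode t x q → InNode X x (p ++ q)
  InNode-++ {X} p q at≡ (u , at-u , x∈u) = u , trans (at-++ X p q at≡) at-u , x∈u

  ∈compList⇒child : ∀ (ts : List (RTree (Subset n))) {x} → x ∈ compList ts → ∃ λ i → ∃ λ w → atList ts i [] ≡ just w × x ∈ comp w
  ∈compList⇒child []       x∈ = ⊥-elim (∉⊥ x∈)
  ∈compList⇒child (t ∷ ts) x∈ with x∈p∪q⁻ (comp t) (compList ts) x∈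
  ... | inj₁ x∈t  = zero , t , refl , x∈t
  ... | inj₂ x∈ts = let i , w , at≡ , x∈w = ∈compList⇒child ts x∈ts in suc i , w , at≡ , x∈w

  child-comp⊆compList : ∀ (ts : List (RTree (Subset n))) {i w x} → atList ts i [] ≡ just w → x ∈ comp w → x ∈ compList ts
  child-comp⊆compList (t ∷ ts) {zero}  refl x∈ = x∈p∪q⁺ (inj₁ x∈)
  child-comp⊆compList (t ∷ ts) {suc i} at≡  x∈ = x∈p∪q⁺ {p = comp t} (inj₂ (child-comp⊆compList ts at≡ x∈))

  module _ {G : Graph n} {X : RTree (Subset n)} (CD : IsCutDecomposition G X) where
    open IsCutDecomposition CD

    edge⇒comparable : ∀ {u v p q} → Adj G u v → InNode X u p → InNode X v q → p ≼ q ⊎ q ≼ p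
    edge⇒comparable {u} {v} {p} {q} uv u∈p v∈q with edges u v uv
    ... | p′ , q′ , u∈p′ , v∈q′ , cmp
      rewrite unique u p′ p u∈p′ u∈p | unique v q′ q v∈q′ v∈q = cmp

    adjacent-children⇒≡ : ∀ p {C ts i j w w′ u v} → at X p ≡ just (node C ts) →
      atList ts i [] ≡ just w → atList ts j [] ≡ just w′ → u ∈ comp w → v ∈ comp w′ → Adj G u v → i ≡ j
    adjacent-children⇒≡ p {C} {ts} {i} {j} {w} {w′} at-p at-w at-w′ u∈w v∈w′ uv
      with ∈comp⇒InNode w u∈w | ∈comp⇒InNode w′ v∈w′
    ... | r₁ , u∈ | r₂ , v∈
      with edge⇒comparable uv (InNode-++ p (i ∷ r₁) at-p (InNode-++ {X = node C ts} (i ∷ []) r₁ at-w u∈))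
                              (InNode-++ p (j ∷ r₂) at-p (InNode-++ {X = node C ts} (j ∷ []) r₂ at-w′ v∈))
    ... | inj₁ ≼ = ≼-sibling p ≼
    ... | inj₂ ≽ = sym (≼-sibling p ≽)

    child-neighbour∈label : ∀ p {C ts i w u s} → at X p ≡ just (node C ts) → atList ts i [] ≡ just w →
      u ∈ comp w → Adj G u s → s ∈ comp (node C ts) → s ∉ comp w → s ∈ C
    child-neighbour∈label p {C} {ts} {s = s} at-p at-w u∈w us s∈t s∉w with x∈p∪q⁻ C (compList ts) s∈t
    ... | inj₁ s∈C  = s∈C
    ... | inj₂ s∈ts =
      let j , w′ , at-w′ , s∈w′ = ∈compList⇒child ts s∈ts
          i≡j = adjacent-children⇒≡ p at-p at-w at-w′ u∈w s∈w′ us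
          w′≡w = just-injective (trans (sym at-w′) (subst (λ k → atList ts k [] ≡ just _) i≡j at-w))
      in ⊥-elim (s∉w (subst (λ v → s ∈ comp v) w′≡w s∈w′))

  module _ (θ : Subset n → ℕ) where

    child-load≤maxLoad : ∀ (ts : List (RTree (Subset n))) i {w} → atList ts i [] ≡ just w → load* θ w ≤ maxLoad θ ts
    child-load≤maxLoad (t ∷ ts) zero    refl = m≤m⊔n _ _
    child-load≤maxLoad (t ∷ ts) (suc i) at-w = ≤-trans (child-load≤maxLoad ts i at-w) (m≤n⊔m (load* θ t) _)

    module _ (δ : ℕ) where

      child-time≤maxTime : ∀ (ts : List (RTree (Subset n))) i {w} → atList ts i [] ≡ just w → time* θ δ w ≤ maxTime θ δ ts
      child-time≤maxTime (t ∷ ts) zero    refl = m≤m⊔n _ _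
      child-time≤maxTime (t ∷ ts) (suc i) at-w = ≤-trans (child-time≤maxTime ts i at-w) (m≤n⊔m (time* θ δ t) _)

      time*-positive : ∀ t → 1 ≤ time* θ δ t
      time*-positive (node C [])       = m≤n+m 1 (θ C * δ)
      time*-positive (node C (t ∷ ts)) =
        *-mono-≤ {1} {θ C * δ + 1} (m≤n+m 1 (θ C * δ)) (≤-trans (time*-positive t) (m≤m⊔n _ _))

sum-const : ∀ k d → sum {k} (λ _ → d) ≡ k * d
sum-const zero    d = refl
sum-const (suc k) d = cong (d +_) (sum-const k d)

sum-updateAt-pred : ∀ {k} (m : Vector ℕ k) c → 0 < m c → sum m ≡ suc (sum (updateAt m c pred))
sum-updateAt-pred {suc k} m c 0<mc = begin
  sum m                                            ≡⟨ sum-remove {i = c} m ⟩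
  m c + sum (removeAt m c)                         ≡⟨ cong₂ _+_ (sym (suc-pred (m c) ⦃ >-nonZero 0<mc ⦄)) removed ⟩
  suc (pred (m c)) + sum (removeAt m′ c)           ≡⟨ cong (λ x → suc x + sum (removeAt m′ c)) (sym (updateAt-updates c m)) ⟩
  suc (m′ c + sum (removeAt m′ c))                 ≡⟨ cong suc (sym (sum-remove {i = c} m′)) ⟩
  suc (sum m′)                                     ∎
  where
    open ≡-Reasoning
    m′ : Vector ℕ (suc k)
    m′ = updateAt m c pred
    removed : sum (removeAt m c) ≡ sum (removeAt m′ c)
    removed = sum-cong-≗ λ j → sym (updateAt-minimal (punchIn c j) c m (punchInᵢ≢i c j))

module Strategies {n : ℕ} (G : Graph n) (dist : Fin n → Fin n → ℕ) (isDist : IsDistance G dist)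
  (δ : ℕ) (diam : ∀ u v → dist u v ≤ δ)
  (θ : Subset n → ℕ) (cover : ∀ A → HasCliqueCover G A (θ A))
  (X : RTree (Subset n)) (CD : IsCutDecomposition G X) (S : Subset n) where

  open Distance G dist isDist

  SurvivorMove : Fin n → Fin n → Set
  SurvivorMove s s' = (s' ≡ s ⊎ Adj G s s') × s' ∈ S

  open Pursuit LazyMove SurvivorMove public

  Exits : Subset n → Fin n → Set
  Exits A s = s ∉ A × ∃ λ u → u ∈ A × Adj G u s

  KeepsRest : {R O : Set} → (R ⊎ O → Fin n) → (R ⊎ O → Fin n) → Set
  KeepsRest zs zs' = ∀ o → zs' (inj₂ o) ≡ zs (inj₂ o)

  Escapes : {R O : Set} → Subset n → (R ⊎ O → Fin n) → (R ⊎ O → Fin n) → Fin n → Set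
  Escapes A zs zs' s' = Exits A s' × KeepsRest zs zs'

  -- The team Fin (load* θ t) plays; the bystanders O must not move.
  Strategy : RTree (Subset n) → Set₁
  Strategy t = ∀ p → at X p ≡ just t → ∀ {O : Set} (zs : Fin (load* θ t) ⊎ O → Fin n) {s} → s ∈ comp t →
    CanCaptureOr (time* θ δ t) (Escapes (comp t) zs) zs s

  module Node (p : List ℕ) {C ts} (at-p : at X p ≡ just (node C ts))
    (child-strategy : ∀ i {w} → atList ts i [] ≡ just w → Strategy w)
    (M T : ℕ) (1≤T : 1 ≤ T)
    (child-load : ∀ i {w} → atList ts i [] ≡ just w → load* θ w ≤ M)
    (child-time : ∀ i {w} → atList ts i [] ≡ just w → time* θ δ w ≤ T)
    {O : Set} where

    t : RTree (Subset n)
    t = node C ts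

    K : Fin (θ C) → Subset n
    K = proj₁ (cover C)

    K-cliques : ∀ c → IsClique G (K c)
    K-cliques = proj₁ (proj₂ (proj₂ (cover C)))

    K-covers : ∀ u → u ∈ C → ∃ λ c → u ∈ K c
    K-covers = proj₂ (proj₂ (proj₂ (cover C)))

    -- Fin M is shared by the children, guard c watches the clique K c.
    Team : Set
    Team = Fin M ⊎ (Fin (θ C) ⊎ O)

    guard : Fin (θ C) → Team
    guard c = inj₂ (inj₁ c)

    Budget : (Team → Fin n) → Vector ℕ (θ C) → Set
    Budget zs m = ∀ c → WithinDist (m c) (zs (guard c)) (K c)

    Idle : (Team → Fin n) → (Team → Fin n) → Set
    Idle zs zs' = ∀ o → zs' (inj₂ (inj₂ o)) ≡ zs (inj₂ (inj₂ o))

    moveGuard : Fin (θ C) → Fin n → (Team → Fin n) → Team → Fin n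
    moveGuard c z zs (inj₁ r)         = zs (inj₁ r)
    moveGuard c z zs (inj₂ (inj₁ c′)) = updateAt (zs ∘ guard) c (λ _ → z) c′
    moveGuard c z zs (inj₂ (inj₂ o))  = zs (inj₂ (inj₂ o))

    moveGuard-moves : ∀ {c z zs s} → LazyMove s (zs (guard c)) z → ∀ j → LazyMove s (zs j) (moveGuard c z zs j)
    moveGuard-moves                 mv (inj₁ r)         = inj₁ refl
    moveGuard-moves {c} {z} {zs} {s} mv (inj₂ (inj₁ c′)) with c′ ≟ c
    ... | yes refl = subst (LazyMove s (zs (guard c))) (sym (updateAt-updates c (zs ∘ guard))) mv
    ... | no c′≢c  = inj₁ (updateAt-minimal c′ c (zs ∘ guard) c′≢c)
    moveGuard-moves                 mv (inj₂ (inj₂ o))  = inj₁ refl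

    guardRound : ∀ {zs m s} → Budget zs m → s ∈ C →
      ∃ λ zs' → (∀ j → LazyMove s (zs j) (zs' j)) × Idle zs zs' ×
        (Caught zs' s ⊎ ∃ λ m' → Budget zs' m' × sum m ≡ suc (sum m'))
    guardRound {zs} {m} {s} budget s∈C with K-covers s s∈C
    ... | c , s∈K with budget c s∈K
    ... | x , x∈K , zx≤ with clique-chase (K-cliques c) x∈K s∈K (zs (guard c))
    ... | z , mv , inj₁ z≡s =
      moveGuard c z zs , moveGuard-moves mv , (λ _ → refl) ,
      inj₁ (guard c , trans (updateAt-updates c (zs ∘ guard)) z≡s)
    ... | z , mv , inj₂ (x′ , x′∈K , zx′<) =
      moveGuard c z zs , moveGuard-moves mv , (λ _ → refl) ,
      inj₂ (updateAt m c pred , budget′ , sum-updateAt-pred m c (m<n⇒0<n zx′<m))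
      where
        zx′<m : dist z x′ < m c
        zx′<m = <-≤-trans zx′< zx≤
        budget′ : Budget (moveGuard c z zs) (updateAt m c pred)
        budget′ c′ y∈K with c′ ≟ c
        ... | yes refl = x′ , x′∈K , subst₂ (λ a b → dist a x′ ≤ b)
                           (sym (updateAt-updates c (zs ∘ guard))) (sym (updateAt-updates c m)) (<⇒≤pred zx′<m)
        ... | no c′≢c  = subst₂ (λ a b → WithinDist b a (K c′))
                           (sym (updateAt-minimal c′ c (zs ∘ guard) c′≢c)) (sym (updateAt-minimal c′ c m c′≢c))
                           (budget c′) y∈K

    budget-kept : ∀ {zs zs' m} → KeepsRest zs zs' → Budget zs m → Budget zs' m
    budget-kept {m = m} kept budget c = subst (λ z → WithinDist (m c) z (K c)) (sym (kept (inj₁ c))) (budget c)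

    C⊆comp : ∀ {s} → s ∈ C → s ∈ comp t
    C⊆comp s∈C = x∈p∪q⁺ (inj₁ s∈C)

    enterCore : ∀ {zs s} → s ∈ comp t →
      CanCaptureOr T (λ zs' s' → (Exits (comp t) s' ⊎ s' ∈ C) × KeepsRest zs zs') zs s
    enterCore {zs} s∈t with x∈p∪q⁻ C (compList ts) s∈t
    ... | inj₁ s∈C  = goal⇒canCaptureOr 1≤T (inj₂ s∈C , λ _ → refl)
    ... | inj₂ s∈ts with ∈compList⇒child ts s∈ts
    ... | i , w , at-w , s∈w with Fin-split (child-load i at-w)
    ... | r , split =
      canCaptureOr-mono-≤ (child-time i at-w)
        (canCaptureOr-reindex e leave (λ j → cong zs (sym (strictlyInverseʳ j)))
          (child-strategy i at-w (p ++ i ∷ []) (trans (at-++ X p (i ∷ []) at-p) at-w) (zs ∘ from) s∈w))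
      where
        e : Team ↔ (Fin (load* θ w) ⊎ (Fin r ⊎ (Fin (θ C) ⊎ O)))
        e = regroup split
        open Inverse e
        leave : ∀ ys {zs' s'} → zs' ≗ ys ∘ to → Escapes (comp w) (zs ∘ from) ys s' →
          (Exits (comp t) s' ⊎ s' ∈ C) × KeepsRest zs zs'
        leave _ {s' = s'} zs'≗ ((s'∉w , u , u∈w , us') , kept) = exit-or-core , λ o → trans (zs'≗ (inj₂ o)) (kept (inj₂ o))
          where
            exit-or-core : Exits (comp t) s' ⊎ s' ∈ C
            exit-or-core with s' ∈? comp t
            ... | yes s'∈t = inj₂ (child-neighbour∈label CD p at-p at-w u∈w us' s'∈t s'∉w)
            ... | no s'∉t  = inj₁ (s'∉t , u , x∈p∪q⁺ {p = C} (inj₂ (child-comp⊆compList ts at-w u∈w)) , us')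

    module _ (zs₀ : Team → Fin n) where

      Goal : (Team → Fin n) → Fin n → Set
      Goal zs s = Exits (comp t) s × Idle zs₀ zs

      mutual
        fromCore : ∀ P {zs m s} → sum m ≤ P → Budget zs m → Idle zs₀ zs → s ∈ C →
          CanCaptureOr (suc (P * T)) Goal zs s
        fromCore P ≤P budget idle s∈C with guardRound budget s∈C
        ... | zs' , mv , idle' , inj₁ caught = inj₂ (inj₂ (zs' , mv , inj₁ caught))
        ... | zs' , mv , idle' , inj₂ (m' , budget' , sum≡) =
          inj₂ (inj₂ (zs' , mv , inj₂ λ s' sm → afterRound P (subst (_≤ P) sum≡ ≤P) budget'
                                                    (λ o → trans (idle' o) (idle o)) s∈C sm))

        afterRound : ∀ P {zs m s s'} → suc (sum m) ≤ P → Budget zs m → Idle zs₀ zs → s ∈ C →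
          SurvivorMove s s' → CanCaptureOr (P * T) Goal zs s'
        afterRound (suc P) {s = s} {s'} ≤P budget idle s∈C (moved , _) with s' ∈? comp t
        ... | yes s'∈t = fromAnywhere P (s≤s⁻¹ ≤P) budget idle s'∈t
        ... | no s'∉t  = goal⇒canCaptureOr (≤-trans 1≤T (m≤m+n T (P * T))) ((s'∉t , s , C⊆comp s∈C , adj moved) , idle)
          where
            adj : s' ≡ s ⊎ Adj G s s' → Adj G s s'
            adj (inj₁ s'≡s) = ⊥-elim (s'∉t (subst (_∈ comp t) (sym s'≡s) (C⊆comp s∈C)))
            adj (inj₂ ss')  = ss'

        fromAnywhere : ∀ P {zs m s} → sum m ≤ P → Budget zs m → Idle zs₀ zs → s ∈ comp t →
          CanCaptureOr (suc P * T) Goal zs s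
        fromAnywhere P {zs} ≤P budget idle s∈t = canCaptureOr-bind 1≤T (enterCore s∈t) next
          where
            next : ∀ {zs' s'} → (Exits (comp t) s' ⊎ s' ∈ C) × KeepsRest zs zs' →
              CanCaptureOr (suc (P * T)) Goal zs' s'
            next (inj₁ exits , kept) = goal⇒canCaptureOr (s≤s z≤n) (exits , λ o → trans (kept (inj₂ o)) (idle o))
            next {zs'} (inj₂ s'∈C  , kept) =
              fromCore P ≤P (budget-kept {zs} {zs'} kept budget) (λ o → trans (kept (inj₂ o)) (idle o)) s'∈C

      result : ∀ {s} → s ∈ comp t → CanCaptureOr ((θ C * δ + 1) * T) Goal zs₀ s
      result {s} s∈t = subst (λ T′ → CanCaptureOr T′ Goal zs₀ s) (cong (_* T) (+-comm 1 (θ C * δ)))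
        (fromAnywhere (θ C * δ) (≤-reflexive (sum-const (θ C) δ)) (λ c {y} y∈K → y , y∈K , diam _ _) (λ _ → refl) s∈t)

  node-strategy : ∀ C ts T → 1 ≤ T → (∀ i {w} → atList ts i [] ≡ just w → time* θ δ w ≤ T) →
    time* θ δ (node C ts) ≡ (θ C * δ + 1) * T →
    (∀ i {w} → atList ts i [] ≡ just w → Strategy w) → Strategy (node C ts)
  node-strategy C ts T 1≤T child-time time≡ child-strategy p at-p {O} zs {s} s∈t =
    subst (λ T′ → CanCaptureOr T′ (Escapes (comp (node C ts)) zs) zs s) (sym time≡)
      (canCaptureOr-reindex e finish
        (λ j → cong zs (sym (strictlyInverseʳ j)))
        (Node.result p at-p child-strategy (maxLoad θ ts) T 1≤T (child-load≤maxLoad θ ts) child-time (zs ∘ from) s∈t))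
    where
      e : (Fin (load* θ (node C ts)) ⊎ O) ↔ (Fin (maxLoad θ ts) ⊎ (Fin (θ C) ⊎ O))
      e = regroup (load*-↔ θ C ts)
      open Inverse e
      finish : ∀ ys {zs' s'} → zs' ≗ ys ∘ to →
        Exits (comp (node C ts)) s' × (∀ o → ys (inj₂ (inj₂ o)) ≡ zs (inj₂ o)) →
        Escapes (comp (node C ts)) zs zs' s'
      finish _ zs'≗ (exits , idle) = exits , λ o → trans (zs'≗ (inj₂ o)) (idle o)

  mutual
    strategy : ∀ t → Strategy t
    strategy (node C []) =
      node-strategy C [] 1 ≤-refl (λ _ ()) (sym (*-identityʳ _)) (children-strategy [])
    strategy (node C (t ∷ ts)) =
      node-strategy C (t ∷ ts) (maxTime θ δ (t ∷ ts)) (≤-trans (time*-positive θ δ t) (m≤m⊔n _ _))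
        (child-time≤maxTime θ δ (t ∷ ts)) refl (children-strategy (t ∷ ts))

    children-strategy : ∀ ts i {w} → atList ts i [] ≡ just w → Strategy w
    children-strategy (t ∷ ts) zero    refl = strategy t
    children-strategy (t ∷ ts) (suc i) at-w = children-strategy ts i at-w

  canCaptureOr⇒CanCapture : ∀ {k T} {Q : (Fin k → Fin n) → Fin n → Set} {zs s} →
    (∀ {zs s} → Q zs s → s ∉ S) → s ∈ S → CanCaptureOr T Q zs s → CanCapture G dist S T zs s
  canCaptureOr⇒CanCapture {T = zero}  _    _   c = c
  canCaptureOr⇒CanCapture {T = suc T} Q∉S s∈S g with g
  ... | inj₁ c                              = inj₁ c
  ... | inj₂ (inj₁ q)                       = ⊥-elim (Q∉S q s∈S)
  ... | inj₂ (inj₂ (zs' , mv , inj₁ c))     = inj₂ (zs' , mv , inj₁ c)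
  ... | inj₂ (inj₂ (zs' , mv , inj₂ next))  =
    inj₂ (zs' , mv , inj₂ λ s' sm → canCaptureOr⇒CanCapture Q∉S (proj₂ sm) (next s' sm))

theorem9 : ∀ {n} (G : Graph n) → Connected G →
    (dist : Fin n → Fin n → ℕ) → IsDistance G dist →
    (δ : ℕ) → IsDiameter G dist δ →
    (θ : Subset n → ℕ) → (∀ S → IsCliqueCoverNumber G S (θ S)) →
    (X : RTree (Subset n)) → IsCutDecomposition G X →
    (p : List ℕ) (v : RTree (Subset n)) → at X p ≡ just v →
    (zs : Fin (load* θ v) → Fin n) (s : Fin n) → s ∈ comp v →
    CanCapture G dist (comp v) (time* θ δ v) zs s
theorem9 G _ dist isDist δ (diam , _) θ θ-cover X CD p v at-v zs s s∈v =
  canCaptureOr⇒CanCapture id s∈v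
    (canCaptureOr-reindex e (λ _ _ goal → proj₁ (proj₁ goal)) (λ _ → refl)
      (strategy v p at-v (zs ∘ from) s∈v))
  where
    open Strategies G dist isDist δ diam θ (proj₁ ∘ θ-cover) X CD (comp v)
    e : Fin (load* θ v) ↔ (Fin (load* θ v) ⊎ Lift 0ℓ ⊥)
    e = ↔-sym (⊎-identityʳ 0ℓ _)
    open Inverse e
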